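{- Let $l\ge 2$ and let $\tau=\underbrace{11\cdots1}_{l-1}2\in[2]^l$ be a subword pattern. Then for every $k\ge 0$, \[ F_\tau(x,y;k)=\frac{1-y}{1-x^{2-l}-y+x^{2-l}\bigl(1-x^{l-1}(1-y)\bigr)^k}. \]
   Context: For a positive integer $k$, $[k]=\{1,\dots,k\}$ and $[k]^n$ is the set of words (strings) of length $n$ over $[k]$; $[0]^n$ is empty for $n\ge1$ and $[0]^0$ contains only the empty word. A subword pattern is a word $\tau=\tau_1\cdots\tau_l\in[m]^l$ containing every letter of $[m]$. An occurrence of $\tau$ in a word $\sigma=\sigma_1\cdots\sigma_n$ is an index $i$ with $1\le i\le n-l+1$ such that the consecutive factor $\sigma_i\sigma_{i+1}\cdots\sigma_{i+l-1}$ is order-isomorphic to $\tau$, i.e. for all $s,t$: $\sigma_{i+s-1}<\sigma_{i+t-1}$ iff $\tau_s<\tau_t$, and $\sigma_{i+s-1}=\sigma_{i+t-1}$ iff $\tau_s=\tau_t$. Let $\sigma(\tau)$ be the number of occurrences of $\tau$ in $\sigma$. Define the formal power series $F_\tau(x,y;k)=\sum_{n\ge0}\sum_{\sigma\in[k]^n}x^n y^{\sigma(\tau)}$. -}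

module Defs where

open import Data.Bool using (Bool; true; false; _∧_; T?)
open import Data.Bool.Properties using () renaming (_≟_ to _≟ᵇ_)
open import Data.Nat using (ℕ; zero; suc; _∸_; _<ᵇ_; _≡ᵇ_; _≟_)
open import Data.Product using (_×_; _,_)
open import Data.List using (List; []; _∷_; [_]; map; concatMap; length; filter; replicate; _++_; take; drop; zip; upTo; foldr)
open import Data.Integer using (ℤ; 0ℤ; 1ℤ; +_; _+_; _*_; -_)
open import Relation.Nullary.Decidable using (does)

letters : ℕ → List ℕ
letters k = map suc (upTo k)

words : ℕ → ℕ → List (List ℕ)
words k zero    = [] ∷ []
words k (suc n) = concatMap (λ w → map (λ a → a ∷ w) (letters k)) (words k n)

sameRel : ℕ × ℕ → ℕ × ℕ → Bool
sameRel (a , p) (b , q) =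
  does ((a <ᵇ b) ≟ᵇ (p <ᵇ q)) ∧ does ((a ≡ᵇ b) ≟ᵇ (p ≡ᵇ q))

allᵇ : {A : Set} → (A → Bool) → List A → Bool
allᵇ p []       = true
allᵇ p (x ∷ xs) = p x ∧ allᵇ p xs

orderIso : List ℕ → List ℕ → Bool
orderIso u v =
  (length u ≡ᵇ length v) ∧ allᵇ (λ x → allᵇ (λ y → sameRel x y) ps) ps
  where ps = zip u v

-- σ(τ): number of indices i (0-based, 0 ≤ i ≤ n - l) such that the
-- factor σ_i … σ_{i+l-1} is order-isomorphic to τ.
occurrences : List ℕ → List ℕ → ℕ
occurrences τ σ =
  length (filter (λ i → T? (orderIso (take (length τ) (drop i σ)) τ))
                 (upTo (suc (length σ) ∸ length τ)))

-- Formal power series in x, y with integer coefficients, given by their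
-- coefficient function: f n m = coefficient of x^n y^m.

PS : Set
PS = ℕ → ℕ → ℤ

sumℤ : List ℤ → ℤ
sumℤ = foldr _+_ 0ℤ

const : ℤ → PS
const c zero zero = c
const c _    _    = 0ℤ

𝟙 : PS
𝟙 = const 1ℤ

X : PS
X (suc zero) zero = 1ℤ
X _          _    = 0ℤ

Y : PS
Y zero (suc zero) = 1ℤ
Y _    _          = 0ℤ

_⊕_ : PS → PS → PS
(f ⊕ g) n m = f n m + g n m

⊖_ : PS → PS
(⊖ f) n m = - f n m

_⊝_ : PS → PS → PS
f ⊝ g = f ⊕ (⊖ g)

_⊛_ : PS → PS → PS
(f ⊛ g) n m =
  sumℤ (map (λ a → sumℤ (map (λ b → f a b * g (n ∸ a) (m ∸ b))
                               (upTo (suc m))))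
            (upTo (suc n)))

_^ˢ_ : PS → ℕ → PS
f ^ˢ zero  = 𝟙
f ^ˢ suc e = f ⊛ (f ^ˢ e)

infixl 6 _⊕_ _⊝_
infixl 7 _⊛_
infixr 8 _^ˢ_

-- The generating function F_τ(x,y;k) = Σ_n Σ_{σ ∈ [k]^n} x^n y^{σ(τ)}:
-- coefficient of x^n y^m = #{σ ∈ [k]^n : σ(τ) = m}.

F : List ℕ → ℕ → PS
F τ k n m = + length (filter (λ σ → occurrences τ σ ≟ m) (words k n))

pattern1s2 : ℕ → List ℕ
pattern1s2 l = replicate (l ∸ 1) 1 ++ [ 2 ]

-- Lower every letter by one, so that words over [k + 1] use the letters 0, …, k and 0 is the
-- smallest. Cutting a word before its first 0 writes it uniquely as a word over {1, …, k}
-- followed by a word that is empty or starts with 0, and no occurrence of 1^{l-1}2 straddles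
-- the cut; hence F_{k+1} = F_k Q. A word starting with 0 is 0ρ, and the letter 0 opens a new
-- occurrence exactly when ρ = 0^{l-2} ρ′ with ρ′ starting above 0; this gives
-- Q = 1 + x (F_{k+1} - N Z) with N = x^{l-2} (1 - y), where Z = F_{k+1} - Q counts the words
-- starting above 0. Eliminating Z leaves Q (1 - x N - x F_k + x N F_k) = 1, and induction on k
-- yields F_k (N - 1 + (1 - x N)^k) = N, the theorem with its denominator cleared.

module Submission where

open import Defs
open import Algebra.Bundles using (CommutativeRing)
open import Algebra.Solver.Ring.AlmostCommutativeRing using (fromCommutativeRing; _-Raw-AlmostCommutative⟶_)
open import Data.Bool using (Bool; true; false; _∧_; not; if_then_else_)
open import Data.Bool.Properties using (∧-conicalˡ; ∧-conicalʳ; ∧-identityʳ; ∧-zeroʳ; T-≡; ⇔→≡)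
open import Data.Integer using (ℤ; 0ℤ; 1ℤ; _+_; _*_; -_; _-_)
import Data.Integer.Properties as ℤ
open import Data.Integer.Tactic.RingSolver using (solve-∀)
open import Data.List using (List; []; _∷_; [_]; map; concatMap; length; filter; replicate; _++_; take; drop; zip; upTo; applyUpTo)
open import Data.List.Properties using (map-upTo; upTo-∷ʳ; ++-identityʳ)
open import Data.Maybe using (Maybe; just; nothing)
open import Data.Nat using (ℕ; zero; suc; _∸_; _≤_; _<_; _<ᵇ_; _≡ᵇ_; _≟_; _≤?_; z≤n; s≤s) renaming (_+_ to _+ℕ_)
import Data.Nat.Properties as ℕ
open import Data.Product using (∃₂; _×_; _,_)
open import Function using (_∘_; Equivalence; mk⇔)
open import Level using (0ℓ)
open import Relation.Binary.PropositionalEquality hiding ([_])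
import Relation.Binary.Reasoning.Setoid as SetoidReasoning
open import Relation.Nullary using (yes; no)
open import Relation.Nullary.Decidable using (T?)

-- Finite sums

private variable A B : Set

-- Opaque, so that Agda can infer f from ∑ xs f; ⊛-coefficient is where _⊛_ meets it.
opaque
  ∑ : List A → (A → ℤ) → ℤ
  ∑ xs f = sumℤ (map f xs)

  ∑-[] : (f : A → ℤ) → ∑ [] f ≡ 0ℤ
  ∑-[] f = refl

  ∑-∷ : ∀ x (xs : List A) (f : A → ℤ) → ∑ (x ∷ xs) f ≡ f x + ∑ xs f
  ∑-∷ x xs f = refl

  ∑-cong : ∀ (xs : List A) {f g : A → ℤ} → (∀ x → f x ≡ g x) → ∑ xs f ≡ ∑ xs g
  ∑-cong []       f≗g = refl
  ∑-cong (x ∷ xs) f≗g = cong₂ _+_ (f≗g x) (∑-cong xs f≗g)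

  ∑-zero : ∀ (xs : List A) {f : A → ℤ} → (∀ x → f x ≡ 0ℤ) → ∑ xs f ≡ 0ℤ
  ∑-zero []       f≗0 = refl
  ∑-zero (x ∷ xs) f≗0 = trans (cong₂ _+_ (f≗0 x) (∑-zero xs f≗0)) (ℤ.+-identityʳ 0ℤ)

  ∑-distrib-+ : ∀ (xs : List A) (f g : A → ℤ) → ∑ xs (λ x → f x + g x) ≡ ∑ xs f + ∑ xs g
  ∑-distrib-+ []       f g = refl
  ∑-distrib-+ (x ∷ xs) f g =
    trans (cong (f x + g x +_) (∑-distrib-+ xs f g)) (+-interchange (f x) (g x) (∑ xs f) (∑ xs g))
    where
    +-interchange : ∀ (a b c d : ℤ) → a + b + (c + d) ≡ a + c + (b + d)
    +-interchange = solve-∀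

  *-distribˡ-∑ : ∀ c (xs : List A) (f : A → ℤ) → c * ∑ xs f ≡ ∑ xs (λ x → c * f x)
  *-distribˡ-∑ c []       f = ℤ.*-zeroʳ c
  *-distribˡ-∑ c (x ∷ xs) f = trans (ℤ.*-distribˡ-+ c (f x) (∑ xs f)) (cong (c * f x +_) (*-distribˡ-∑ c xs f))

  *-distribʳ-∑ : ∀ c (xs : List A) (f : A → ℤ) → ∑ xs f * c ≡ ∑ xs (λ x → f x * c)
  *-distribʳ-∑ c []       f = ℤ.*-zeroˡ c
  *-distribʳ-∑ c (x ∷ xs) f = trans (ℤ.*-distribʳ-+ c (f x) (∑ xs f)) (cong (f x * c +_) (*-distribʳ-∑ c xs f))

  -‿distrib-∑ : ∀ (xs : List A) (f : A → ℤ) → - ∑ xs f ≡ ∑ xs (λ x → - f x)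
  -‿distrib-∑ []       f = refl
  -‿distrib-∑ (x ∷ xs) f = trans (ℤ.neg-distrib-+ (f x) (∑ xs f)) (cong (- f x +_) (-‿distrib-∑ xs f))

  ∑-map : ∀ (g : A → B) (xs : List A) (f : B → ℤ) → ∑ (map g xs) f ≡ ∑ xs (f ∘ g)
  ∑-map g []       f = refl
  ∑-map g (x ∷ xs) f = cong (f (g x) +_) (∑-map g xs f)

  ∑-++ : ∀ (xs ys : List A) (f : A → ℤ) → ∑ (xs ++ ys) f ≡ ∑ xs f + ∑ ys f
  ∑-++ []       ys f = sym (ℤ.+-identityˡ _)
  ∑-++ (x ∷ xs) ys f = trans (cong (f x +_) (∑-++ xs ys f)) (sym (ℤ.+-assoc (f x) _ _))

  ∑-comm : ∀ (xs : List A) (ys : List B) (f : A → B → ℤ) →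
    ∑ xs (λ x → ∑ ys (f x)) ≡ ∑ ys (λ y → ∑ xs (λ x → f x y))
  ∑-comm []       ys f = sym (∑-zero ys (λ _ → refl))
  ∑-comm (x ∷ xs) ys f =
    trans (cong (∑ ys (f x) +_) (∑-comm xs ys f)) (sym (∑-distrib-+ ys (f x) (λ y → ∑ xs (λ x → f x y))))

  ∑-concatMap : ∀ (g : A → List B) (xs : List A) (f : B → ℤ) →
    ∑ (concatMap g xs) f ≡ ∑ xs (λ x → ∑ (g x) f)
  ∑-concatMap g []       f = refl
  ∑-concatMap g (x ∷ xs) f = trans (∑-++ (g x) (concatMap g xs) f) (cong (∑ (g x) f +_) (∑-concatMap g xs f))

  ⊛-coefficient : ∀ f g n m → (f ⊛ g) n m ≡ ∑ (upTo (suc n)) (λ a → ∑ (upTo (suc m)) (λ b → f a b * g (n ∸ a) (m ∸ b)))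
  ⊛-coefficient f g n m = refl

∑-upTo-suc : ∀ n (f : ℕ → ℤ) → ∑ (upTo (suc n)) f ≡ f 0 + ∑ (upTo n) (f ∘ suc)
∑-upTo-suc n f = begin
  ∑ (0 ∷ applyUpTo suc n) f        ≡⟨ ∑-∷ 0 (applyUpTo suc n) f ⟩
  f 0 + ∑ (applyUpTo suc n) f      ≡⟨ cong (λ is → f 0 + ∑ is f) (sym (map-upTo suc n)) ⟩
  f 0 + ∑ (map suc (upTo n)) f     ≡⟨ cong (f 0 +_) (∑-map suc (upTo n) f) ⟩
  f 0 + ∑ (upTo n) (f ∘ suc)       ∎
  where open ≡-Reasoning

∑-[-] : ∀ (x : A) (f : A → ℤ) → ∑ (x ∷ []) f ≡ f x
∑-[-] x f = trans (∑-∷ x [] f) (trans (cong (f x +_) (∑-[] f)) (ℤ.+-identityʳ (f x)))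

∑-upTo-1 : (f : ℕ → ℤ) → ∑ (upTo 1) f ≡ f 0
∑-upTo-1 = ∑-[-] 0

∑-upTo-sucʳ : ∀ n (f : ℕ → ℤ) → ∑ (upTo (suc n)) f ≡ ∑ (upTo n) f + f n
∑-upTo-sucʳ n f = begin
  ∑ (upTo (suc n)) f                      ≡⟨ cong (λ is → ∑ is f) (sym (upTo-∷ʳ n)) ⟩
  ∑ (upTo n ++ n ∷ []) f                  ≡⟨ ∑-++ (upTo n) (n ∷ []) f ⟩
  ∑ (upTo n) f + ∑ (n ∷ []) f             ≡⟨ cong (∑ (upTo n) f +_) (∑-[-] n f) ⟩
  ∑ (upTo n) f + f n                      ∎
  where open ≡-Reasoning

∑-upTo-head : ∀ n {f : ℕ → ℤ} → (∀ i → f (suc i) ≡ 0ℤ) → ∑ (upTo (suc n)) f ≡ f 0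
∑-upTo-head n {f} tail≗0 =
  trans (∑-upTo-suc n f) (trans (cong (f 0 +_) (∑-zero (upTo n) tail≗0)) (ℤ.+-identityʳ (f 0)))

∑-upTo-cong : ∀ n {f g : ℕ → ℤ} → (∀ i → i < n → f i ≡ g i) → ∑ (upTo n) f ≡ ∑ (upTo n) g
∑-upTo-cong zero    {f} {g} f≗g = trans (∑-[] f) (sym (∑-[] g))
∑-upTo-cong (suc n) {f} {g} f≗g = begin
  ∑ (upTo (suc n)) f           ≡⟨ ∑-upTo-suc n f ⟩
  f 0 + ∑ (upTo n) (f ∘ suc)   ≡⟨ cong₂ _+_ (f≗g 0 (s≤s z≤n)) (∑-upTo-cong n (λ i i<n → f≗g (suc i) (s≤s i<n))) ⟩
  g 0 + ∑ (upTo n) (g ∘ suc)   ≡⟨ sym (∑-upTo-suc n g) ⟩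
  ∑ (upTo (suc n)) g           ∎
  where open ≡-Reasoning

∑-upTo-reverse : ∀ n (f : ℕ → ℤ) → ∑ (upTo n) f ≡ ∑ (upTo n) (λ i → f (n ∸ suc i))
∑-upTo-reverse zero    f = trans (∑-[] f) (sym (∑-[] _))
∑-upTo-reverse (suc n) f = begin
  ∑ (upTo (suc n)) f                           ≡⟨ ∑-upTo-sucʳ n f ⟩
  ∑ (upTo n) f + f n                           ≡⟨ cong (_+ f n) (∑-upTo-reverse n f) ⟩
  ∑ (upTo n) (λ i → f (n ∸ suc i)) + f n       ≡⟨ ℤ.+-comm _ (f n) ⟩
  f n + ∑ (upTo n) (λ i → f (n ∸ suc i))       ≡⟨ sym (∑-upTo-suc n (λ i → f (suc n ∸ suc i))) ⟩
  ∑ (upTo (suc n)) (λ i → f (suc n ∸ suc i))   ∎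
  where open ≡-Reasoning

-- Both sides sum T a c e over all a + c + e = n.
∑-upTo-triangle : ∀ n (T : ℕ → ℕ → ℕ → ℤ) →
  ∑ (upTo (suc n)) (λ b → ∑ (upTo (suc b)) (λ a → T a (b ∸ a) (n ∸ b)))
  ≡ ∑ (upTo (suc n)) (λ a → ∑ (upTo (suc (n ∸ a))) (λ c → T a c (n ∸ a ∸ c)))
∑-upTo-triangle zero    T =
  trans (∑-upTo-1 _) (trans (∑-upTo-1 _) (sym (trans (∑-upTo-1 _) (∑-upTo-1 _))))
∑-upTo-triangle (suc n) T = begin
  ∑ (upTo (suc (suc n))) (λ b → ∑ (upTo (suc b)) (λ a → T a (b ∸ a) (suc n ∸ b)))
    ≡⟨ ∑-upTo-suc (suc n) _ ⟩
  ∑ (upTo 1) (λ a → T a (0 ∸ a) (suc n)) + ∑ (upTo (suc n)) (λ b → ∑ (upTo (suc (suc b))) (λ a → T a (suc b ∸ a) (n ∸ b)))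
    ≡⟨ cong₂ _+_ (∑-upTo-1 _) (∑-cong (upTo (suc n)) (λ b → ∑-upTo-suc (suc b) _)) ⟩
  T 0 0 (suc n) + ∑ (upTo (suc n)) (λ b → T 0 (suc b) (n ∸ b) + ∑ (upTo (suc b)) (λ a → T (suc a) (b ∸ a) (n ∸ b)))
    ≡⟨ cong (T 0 0 (suc n) +_) (∑-distrib-+ (upTo (suc n)) _ _) ⟩
  T 0 0 (suc n) + (∑ (upTo (suc n)) (λ b → T 0 (suc b) (n ∸ b)) + ∑ (upTo (suc n)) (λ b → ∑ (upTo (suc b)) (λ a → T (suc a) (b ∸ a) (n ∸ b))))
    ≡⟨ sym (ℤ.+-assoc (T 0 0 (suc n)) _ _) ⟩
  T 0 0 (suc n) + ∑ (upTo (suc n)) (λ b → T 0 (suc b) (n ∸ b)) + ∑ (upTo (suc n)) (λ b → ∑ (upTo (suc b)) (λ a → T (suc a) (b ∸ a) (n ∸ b)))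
    ≡⟨ cong₂ _+_ (sym (∑-upTo-suc (suc n) (λ c → T 0 c (suc n ∸ c)))) (∑-upTo-triangle n (T ∘ suc)) ⟩
  ∑ (upTo (suc (suc n))) (λ c → T 0 c (suc n ∸ c)) + ∑ (upTo (suc n)) (λ a → ∑ (upTo (suc (n ∸ a))) (λ c → T (suc a) c (n ∸ a ∸ c)))
    ≡⟨ sym (∑-upTo-suc (suc n) _) ⟩
  ∑ (upTo (suc (suc n))) (λ a → ∑ (upTo (suc (suc n ∸ a))) (λ c → T a c (suc n ∸ a ∸ c))) ∎
  where open ≡-Reasoning

-- The ring of formal power series

-- A record rather than ∀ n m → f n m ≡ g n m, so that f and g can be inferred from a proof of f ≈ g.
infix 4 _≈_
record _≈_ (f g : PS) : Set where
  constructor coefficientwise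
  field coeff : ∀ n m → f n m ≡ g n m
open _≈_ using (coeff)

≈-refl : ∀ {f} → f ≈ f
≈-refl = coefficientwise λ _ _ → refl

≈-sym : ∀ {f g} → f ≈ g → g ≈ f
≈-sym f≈g = coefficientwise λ n m → sym (coeff f≈g n m)

≈-trans : ∀ {f g h} → f ≈ g → g ≈ h → f ≈ h
≈-trans f≈g g≈h = coefficientwise λ n m → trans (coeff f≈g n m) (coeff g≈h n m)

𝟘 : PS
𝟘 = const 0ℤ

𝟘-coefficient : ∀ n m → 𝟘 n m ≡ 0ℤ
𝟘-coefficient zero    zero    = refl
𝟘-coefficient zero    (suc m) = refl
𝟘-coefficient (suc n) m       = refl

⊕-cong : ∀ {f f′ g g′} → f ≈ f′ → g ≈ g′ → f ⊕ g ≈ f′ ⊕ g′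
⊕-cong f≈f′ g≈g′ = coefficientwise λ n m → cong₂ _+_ (coeff f≈f′ n m) (coeff g≈g′ n m)

⊖-cong : ∀ {f f′} → f ≈ f′ → ⊖ f ≈ ⊖ f′
⊖-cong f≈f′ = coefficientwise λ n m → cong -_ (coeff f≈f′ n m)

⊛-cong : ∀ {f f′ g g′} → f ≈ f′ → g ≈ g′ → f ⊛ g ≈ f′ ⊛ g′
⊛-cong {f} {f′} {g} {g′} f≈f′ g≈g′ = coefficientwise λ n m → begin
  (f ⊛ g) n m
    ≡⟨ ⊛-coefficient f g n m ⟩
  ∑ (upTo (suc n)) (λ a → ∑ (upTo (suc m)) (λ b → f a b * g (n ∸ a) (m ∸ b)))
    ≡⟨ ∑-cong (upTo (suc n)) (λ a → ∑-cong (upTo (suc m)) (λ b → cong₂ _*_ (coeff f≈f′ a b) (coeff g≈g′ (n ∸ a) (m ∸ b)))) ⟩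
  ∑ (upTo (suc n)) (λ a → ∑ (upTo (suc m)) (λ b → f′ a b * g′ (n ∸ a) (m ∸ b)))
    ≡⟨ ⊛-coefficient f′ g′ n m ⟨
  (f′ ⊛ g′) n m ∎
  where open ≡-Reasoning

⊛-comm : ∀ f g → f ⊛ g ≈ g ⊛ f
⊛-comm f g = coefficientwise λ n m → begin
  (f ⊛ g) n m
    ≡⟨ ⊛-coefficient f g n m ⟩
  ∑ (upTo (suc n)) (λ a → ∑ (upTo (suc m)) (λ b → f a b * g (n ∸ a) (m ∸ b)))
    ≡⟨ ∑-upTo-reverse (suc n) _ ⟩
  ∑ (upTo (suc n)) (λ a → ∑ (upTo (suc m)) (λ b → f (n ∸ a) b * g (n ∸ (n ∸ a)) (m ∸ b)))
    ≡⟨ ∑-cong (upTo (suc n)) (λ a → ∑-upTo-reverse (suc m) _) ⟩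
  ∑ (upTo (suc n)) (λ a → ∑ (upTo (suc m)) (λ b → f (n ∸ a) (m ∸ b) * g (n ∸ (n ∸ a)) (m ∸ (m ∸ b))))
    ≡⟨ ∑-upTo-cong (suc n) (λ a a≤n → ∑-upTo-cong (suc m) (λ b b≤m → trans
         (ℤ.*-comm (f (n ∸ a) (m ∸ b)) _)
         (cong₂ (λ a′ b′ → g a′ b′ * f (n ∸ a) (m ∸ b)) (ℕ.m∸[m∸n]≡n (ℕ.≤-pred a≤n)) (ℕ.m∸[m∸n]≡n (ℕ.≤-pred b≤m))))) ⟩
  ∑ (upTo (suc n)) (λ a → ∑ (upTo (suc m)) (λ b → g a b * f (n ∸ a) (m ∸ b)))
    ≡⟨ ⊛-coefficient g f n m ⟨
  (g ⊛ f) n m ∎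
  where open ≡-Reasoning

⊛-distribˡ-⊕ : ∀ f g h → f ⊛ (g ⊕ h) ≈ f ⊛ g ⊕ f ⊛ h
⊛-distribˡ-⊕ f g h = coefficientwise λ n m → begin
  (f ⊛ (g ⊕ h)) n m
    ≡⟨ ⊛-coefficient f (g ⊕ h) n m ⟩
  ∑ (upTo (suc n)) (λ a → ∑ (upTo (suc m)) (λ b → f a b * (g (n ∸ a) (m ∸ b) + h (n ∸ a) (m ∸ b))))
    ≡⟨ ∑-cong (upTo (suc n)) (λ a → trans
         (∑-cong (upTo (suc m)) (λ b → ℤ.*-distribˡ-+ (f a b) _ _)) (∑-distrib-+ (upTo (suc m)) _ _)) ⟩
  ∑ (upTo (suc n)) (λ a → ∑ (upTo (suc m)) (λ b → f a b * g (n ∸ a) (m ∸ b)) + ∑ (upTo (suc m)) (λ b → f a b * h (n ∸ a) (m ∸ b)))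
    ≡⟨ ∑-distrib-+ (upTo (suc n)) _ _ ⟩
  ∑ (upTo (suc n)) (λ a → ∑ (upTo (suc m)) (λ b → f a b * g (n ∸ a) (m ∸ b)))
    + ∑ (upTo (suc n)) (λ a → ∑ (upTo (suc m)) (λ b → f a b * h (n ∸ a) (m ∸ b)))
    ≡⟨ cong₂ _+_ (⊛-coefficient f g n m) (⊛-coefficient f h n m) ⟨
  (f ⊛ g ⊕ f ⊛ h) n m ∎
  where open ≡-Reasoning

private
  ⊛-triple : PS → PS → PS → PS
  ⊛-triple f g h n m =
    ∑ (upTo (suc n)) λ a → ∑ (upTo (suc m)) λ b → ∑ (upTo (suc (n ∸ a))) λ c → ∑ (upTo (suc (m ∸ b))) λ d →
      f a b * (g c d * h (n ∸ a ∸ c) (m ∸ b ∸ d))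

  ⊛-assocʳ : ∀ f g h → f ⊛ (g ⊛ h) ≈ ⊛-triple f g h
  ⊛-assocʳ f g h = coefficientwise λ n m → trans (⊛-coefficient f (g ⊛ h) n m)
    (∑-cong (upTo (suc n)) λ a → ∑-cong (upTo (suc m)) λ b → begin
      f a b * (g ⊛ h) (n ∸ a) (m ∸ b)
        ≡⟨ cong (f a b *_) (⊛-coefficient g h (n ∸ a) (m ∸ b)) ⟩
      f a b * ∑ (upTo (suc (n ∸ a))) (λ c → ∑ (upTo (suc (m ∸ b))) λ d → g c d * h (n ∸ a ∸ c) (m ∸ b ∸ d))
        ≡⟨ *-distribˡ-∑ (f a b) (upTo (suc (n ∸ a))) _ ⟩
      ∑ (upTo (suc (n ∸ a))) (λ c → f a b * ∑ (upTo (suc (m ∸ b))) λ d → g c d * h (n ∸ a ∸ c) (m ∸ b ∸ d))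
        ≡⟨ ∑-cong (upTo (suc (n ∸ a))) (λ c → *-distribˡ-∑ (f a b) (upTo (suc (m ∸ b))) _) ⟩
      ∑ (upTo (suc (n ∸ a))) (λ c → ∑ (upTo (suc (m ∸ b))) λ d → f a b * (g c d * h (n ∸ a ∸ c) (m ∸ b ∸ d))) ∎)
    where open ≡-Reasoning

  ⊛-assocˡ : ∀ f g h → (f ⊛ g) ⊛ h ≈ ⊛-triple f g h
  ⊛-assocˡ f g h = coefficientwise λ n m → begin
    ((f ⊛ g) ⊛ h) n m
      ≡⟨ ⊛-coefficient (f ⊛ g) h n m ⟩
    ∑ (upTo (suc n)) (λ a → ∑ (upTo (suc m)) λ b → (f ⊛ g) a b * h (n ∸ a) (m ∸ b))
      ≡⟨ ∑-cong (upTo (suc n)) (λ a → ∑-cong (upTo (suc m)) λ b → expand n m a b) ⟩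
    ∑ (upTo (suc n)) (λ a → ∑ (upTo (suc m)) λ b → ∑ (upTo (suc a)) λ a′ → ∑ (upTo (suc b)) λ b′ →
       f a′ b′ * (g (a ∸ a′) (b ∸ b′) * h (n ∸ a) (m ∸ b)))
      ≡⟨ ∑-cong (upTo (suc n)) (λ a → ∑-comm (upTo (suc m)) (upTo (suc a)) _) ⟩
    ∑ (upTo (suc n)) (λ a → ∑ (upTo (suc a)) λ a′ → ∑ (upTo (suc m)) λ b → ∑ (upTo (suc b)) λ b′ →
       f a′ b′ * (g (a ∸ a′) (b ∸ b′) * h (n ∸ a) (m ∸ b)))
      ≡⟨ ∑-upTo-triangle n (λ a′ c e → ∑ (upTo (suc m)) λ b → ∑ (upTo (suc b)) λ b′ → f a′ b′ * (g c (b ∸ b′) * h e (m ∸ b))) ⟩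
    ∑ (upTo (suc n)) (λ a′ → ∑ (upTo (suc (n ∸ a′))) λ c → ∑ (upTo (suc m)) λ b → ∑ (upTo (suc b)) λ b′ →
       f a′ b′ * (g c (b ∸ b′) * h (n ∸ a′ ∸ c) (m ∸ b)))
      ≡⟨ ∑-cong (upTo (suc n)) (λ a′ → ∑-cong (upTo (suc (n ∸ a′))) λ c →
           ∑-upTo-triangle m (λ b′ d e → f a′ b′ * (g c d * h (n ∸ a′ ∸ c) e))) ⟩
    ∑ (upTo (suc n)) (λ a′ → ∑ (upTo (suc (n ∸ a′))) λ c → ∑ (upTo (suc m)) λ b′ → ∑ (upTo (suc (m ∸ b′))) λ d →
       f a′ b′ * (g c d * h (n ∸ a′ ∸ c) (m ∸ b′ ∸ d)))
      ≡⟨ ∑-cong (upTo (suc n)) (λ a′ → ∑-comm (upTo (suc (n ∸ a′))) (upTo (suc m)) _) ⟩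
    ⊛-triple f g h n m ∎
    where
    open ≡-Reasoning
    expand : ∀ n m a b → (f ⊛ g) a b * h (n ∸ a) (m ∸ b)
      ≡ ∑ (upTo (suc a)) λ a′ → ∑ (upTo (suc b)) λ b′ → f a′ b′ * (g (a ∸ a′) (b ∸ b′) * h (n ∸ a) (m ∸ b))
    expand n m a b = begin
      (f ⊛ g) a b * h (n ∸ a) (m ∸ b)
        ≡⟨ cong (_* h (n ∸ a) (m ∸ b)) (⊛-coefficient f g a b) ⟩
      ∑ (upTo (suc a)) (λ a′ → ∑ (upTo (suc b)) λ b′ → f a′ b′ * g (a ∸ a′) (b ∸ b′)) * h (n ∸ a) (m ∸ b)
        ≡⟨ *-distribʳ-∑ _ (upTo (suc a)) _ ⟩
      ∑ (upTo (suc a)) (λ a′ → ∑ (upTo (suc b)) (λ b′ → f a′ b′ * g (a ∸ a′) (b ∸ b′)) * h (n ∸ a) (m ∸ b))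
        ≡⟨ ∑-cong (upTo (suc a)) (λ a′ → trans (*-distribʳ-∑ _ (upTo (suc b)) _)
             (∑-cong (upTo (suc b)) λ b′ → ℤ.*-assoc (f a′ b′) _ _)) ⟩
      ∑ (upTo (suc a)) (λ a′ → ∑ (upTo (suc b)) λ b′ → f a′ b′ * (g (a ∸ a′) (b ∸ b′) * h (n ∸ a) (m ∸ b))) ∎

⊛-assoc : ∀ f g h → (f ⊛ g) ⊛ h ≈ f ⊛ (g ⊛ h)
⊛-assoc f g h = ≈-trans (⊛-assocˡ f g h) (≈-sym (⊛-assocʳ f g h))

const-⊛ : ∀ c f → const c ⊛ f ≈ λ n m → c * f n m
const-⊛ c f = coefficientwise λ n m → begin
  (const c ⊛ f) n m
    ≡⟨ ⊛-coefficient (const c) f n m ⟩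
  ∑ (upTo (suc n)) (λ a → ∑ (upTo (suc m)) (λ b → const c a b * f (n ∸ a) (m ∸ b)))
    ≡⟨ ∑-upTo-head n (λ a → ∑-zero (upTo (suc m)) (λ b → ℤ.*-zeroˡ (f (n ∸ suc a) (m ∸ b)))) ⟩
  ∑ (upTo (suc m)) (λ b → const c 0 b * f n (m ∸ b))
    ≡⟨ ∑-upTo-head m (λ b → ℤ.*-zeroˡ (f n (m ∸ suc b))) ⟩
  c * f n m ∎
  where open ≡-Reasoning

⊛-identityˡ : ∀ f → 𝟙 ⊛ f ≈ f
⊛-identityˡ f = coefficientwise λ n m → trans (coeff (const-⊛ 1ℤ f) n m) (ℤ.*-identityˡ (f n m))

PS-commutativeRing : CommutativeRing 0ℓ 0ℓ
PS-commutativeRing = record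
  { Carrier = PS ; _≈_ = _≈_ ; _+_ = _⊕_ ; _*_ = _⊛_ ; -_ = ⊖_ ; 0# = 𝟘 ; 1# = 𝟙
  ; isCommutativeRing = record
    { isRing = record
      { +-isAbelianGroup = record
        { isGroup = record
          { isMonoid = record
            { isSemigroup = record
              { isMagma = record
                { isEquivalence = record
                  { refl = ≈-refl ; sym = ≈-sym ; trans = ≈-trans }
                ; ∙-cong = ⊕-cong }
              ; assoc = λ f g h → coefficientwise λ n m → ℤ.+-assoc (f n m) (g n m) (h n m) }
            ; identity = (λ f → coefficientwise λ n m → trans (cong (_+ f n m) (𝟘-coefficient n m)) (ℤ.+-identityˡ (f n m)))
                       , (λ f → coefficientwise λ n m → trans (cong (f n m +_) (𝟘-coefficient n m)) (ℤ.+-identityʳ (f n m))) }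
          ; inverse = (λ f → coefficientwise λ n m → trans (ℤ.+-inverseˡ (f n m)) (sym (𝟘-coefficient n m)))
                    , (λ f → coefficientwise λ n m → trans (ℤ.+-inverseʳ (f n m)) (sym (𝟘-coefficient n m)))
          ; ⁻¹-cong = ⊖-cong }
        ; comm = λ f g → coefficientwise λ n m → ℤ.+-comm (f n m) (g n m) }
      ; *-cong = ⊛-cong
      ; *-assoc = ⊛-assoc
      ; *-identity = ⊛-identityˡ , (λ f → ≈-trans (⊛-comm f 𝟙) (⊛-identityˡ f))
      ; distrib = ⊛-distribˡ-⊕
                , (λ f g h → ≈-trans (⊛-comm (g ⊕ h) f) (≈-trans (⊛-distribˡ-⊕ f g h) (⊕-cong (⊛-comm f g) (⊛-comm f h)))) }
    ; *-comm = ⊛-comm } }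

const-homomorphism : CommutativeRing.rawRing ℤ.+-*-commutativeRing -Raw-AlmostCommutative⟶ fromCommutativeRing PS-commutativeRing
const-homomorphism = record
  { ⟦_⟧    = const
  ; +-homo = λ a b → coefficientwise λ { zero zero → refl ; zero (suc m) → refl ; (suc n) m → refl }
  ; *-homo = λ a b → coefficientwise λ n m → trans (const-* a b n m) (sym (coeff (const-⊛ a (const b)) n m))
  ; -‿homo = λ a → coefficientwise λ { zero zero → refl ; zero (suc m) → refl ; (suc n) m → refl }
  ; 0-homo = ≈-refl
  ; 1-homo = ≈-refl }
  where
  const-* : ∀ a b n m → const (a * b) n m ≡ a * const b n m
  const-* a b zero    zero    = refl
  const-* a b zero    (suc m) = sym (ℤ.*-zeroʳ a)
  const-* a b (suc n) m       = sym (ℤ.*-zeroʳ a)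

const-≟ : ∀ (a b : ℤ) → Maybe (const a ≈ const b)
const-≟ a b with a ℤ.≟ b
... | yes refl = just ≈-refl
... | no _     = nothing

open import Algebra.Solver.Ring (CommutativeRing.rawRing ℤ.+-*-commutativeRing) (fromCommutativeRing PS-commutativeRing)
  const-homomorphism const-≟ using (solve; _:+_; _:*_; _:-_; :-_; _:=_; con)

module ≈-Reasoning = SetoidReasoning (CommutativeRing.setoid PS-commutativeRing)

shift : ℕ → (ℕ → ℤ) → ℕ → ℤ
shift zero    s n       = s n
shift (suc i) s zero    = 0ℤ
shift (suc i) s (suc n) = shift i s n

shift-cong : ∀ i {s t : ℕ → ℤ} → (∀ n → s n ≡ t n) → ∀ n → shift i s n ≡ shift i t n
shift-cong zero    s≗t n       = s≗t n
shift-cong (suc i) s≗t zero    = refl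
shift-cong (suc i) s≗t (suc n) = shift-cong i s≗t n

shift-neg : ∀ i (s : ℕ → ℤ) n → shift i (λ n′ → - s n′) n ≡ - shift i s n
shift-neg zero    s n       = refl
shift-neg (suc i) s zero    = refl
shift-neg (suc i) s (suc n) = shift-neg i s n

X-⊛ : ∀ f n m → (X ⊛ f) n m ≡ shift 1 (λ n′ → f n′ m) n
X-⊛ f n m = trans (⊛-coefficient X f n m) (trans (∑-upTo-suc n _) (trans
  (cong₂ _+_ (∑-zero (upTo (suc m)) (λ b → ℤ.*-zeroˡ (f n (m ∸ b)))) (lower n))
  (ℤ.+-identityˡ _)))
  where
  lower : ∀ n → ∑ (upTo n) (λ a → ∑ (upTo (suc m)) (λ b → X (suc a) b * f (n ∸ suc a) (m ∸ b))) ≡ shift 1 (λ n′ → f n′ m) n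
  lower zero    = ∑-[] _
  lower (suc n) = trans (∑-upTo-head n (λ a → ∑-zero (upTo (suc m)) (λ b → ℤ.*-zeroˡ (f (n ∸ suc a) (m ∸ b)))))
                        (trans (∑-upTo-head m (λ b → ℤ.*-zeroˡ (f n (m ∸ suc b)))) (ℤ.*-identityˡ (f n m)))

X^-⊛ : ∀ i f n m → (X ^ˢ i ⊛ f) n m ≡ shift i (λ n′ → f n′ m) n
X^-⊛ zero    f n m = coeff (⊛-identityˡ f) n m
X^-⊛ (suc i) f n m = begin
  ((X ⊛ X ^ˢ i) ⊛ f) n m                    ≡⟨ coeff (⊛-assoc X (X ^ˢ i) f) n m ⟩
  (X ⊛ (X ^ˢ i ⊛ f)) n m                    ≡⟨ X-⊛ (X ^ˢ i ⊛ f) n m ⟩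
  shift 1 (λ n′ → (X ^ˢ i ⊛ f) n′ m) n      ≡⟨ shift-cong 1 (λ n′ → X^-⊛ i f n′ m) n ⟩
  shift 1 (shift i (λ n′ → f n′ m)) n       ≡⟨ shift-suc n ⟩
  shift (suc i) (λ n′ → f n′ m) n           ∎
  where
  open ≡-Reasoning
  shift-suc : ∀ n → shift 1 (shift i (λ n′ → f n′ m)) n ≡ shift (suc i) (λ n′ → f n′ m) n
  shift-suc zero    = refl
  shift-suc (suc n) = refl

Y-⊛ : ∀ f n m → (Y ⊛ f) n m ≡ shift 1 (f n) m
Y-⊛ f n m = trans (⊛-coefficient Y f n m)
  (trans (∑-upTo-head n (λ a → ∑-zero (upTo (suc m)) (λ b → ℤ.*-zeroˡ (f (n ∸ suc a) (m ∸ b))))) (lower m))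
  where
  lower : ∀ m → ∑ (upTo (suc m)) (λ b → Y 0 b * f n (m ∸ b)) ≡ shift 1 (f n) m
  lower zero    = trans (∑-upTo-1 _) (ℤ.*-zeroˡ (f n 0))
  lower (suc m) = begin
    ∑ (upTo (suc (suc m))) (λ b → Y 0 b * f n (suc m ∸ b))       ≡⟨ ∑-upTo-suc (suc m) _ ⟩
    0ℤ * f n (suc m) + ∑ (upTo (suc m)) (λ b → Y 0 (suc b) * f n (m ∸ b))
      ≡⟨ ℤ.+-identityˡ _ ⟩
    ∑ (upTo (suc m)) (λ b → Y 0 (suc b) * f n (m ∸ b))           ≡⟨ ∑-upTo-head m (λ b → ℤ.*-zeroˡ (f n (m ∸ suc b))) ⟩
    1ℤ * f n m                                                    ≡⟨ ℤ.*-identityˡ (f n m) ⟩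
    f n m                                                         ∎
    where open ≡-Reasoning

𝕀 : Bool → ℤ
𝕀 b = if b then 1ℤ else 0ℤ

δ : ℕ → ℕ → ℤ
δ a m = 𝕀 (a ≡ᵇ m)

δ₀≡𝟙₀ : ∀ m → δ 0 m ≡ 𝟙 0 m
δ₀≡𝟙₀ zero    = refl
δ₀≡𝟙₀ (suc m) = refl

δ-+ : ∀ x y m → δ (x +ℕ y) m ≡ ∑ (upTo (suc m)) (λ b → δ x b * δ y (m ∸ b))
δ-+ zero    y m       = sym (trans (∑-upTo-head m (λ b → ℤ.*-zeroˡ (δ y (m ∸ suc b)))) (ℤ.*-identityˡ (δ y m)))
δ-+ (suc x) y zero    = sym (trans (∑-upTo-1 _) (ℤ.*-zeroˡ (δ y 0)))
δ-+ (suc x) y (suc m) = begin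
  δ (x +ℕ y) m                                                    ≡⟨ δ-+ x y m ⟩
  ∑ (upTo (suc m)) (λ b → δ x b * δ y (m ∸ b))                     ≡⟨ ℤ.+-identityˡ _ ⟨
  0ℤ * δ y (suc m) + ∑ (upTo (suc m)) (λ b → δ x b * δ y (m ∸ b))  ≡⟨ ∑-upTo-suc (suc m) _ ⟨
  ∑ (upTo (suc (suc m))) (λ b → δ (suc x) b * δ y (suc m ∸ b))     ∎
  where open ≡-Reasoning

-- Occurrences of 1^{j+1}2

runAscent : ℕ → ℕ → List ℕ → Bool
runAscent c zero    []      = false
runAscent c zero    (d ∷ _) = c <ᵇ d
runAscent c (suc i) []      = false
runAscent c (suc i) (d ∷ w) = (c ≡ᵇ d) ∧ runAscent c i w

occ : ℕ → List ℕ → ℕ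
occ j []      = 0
occ j (a ∷ w) = if runAscent a j w then suc (occ j w) else occ j w

sameRel-11 : ∀ a d → sameRel (a , 1) (d , 1) ≡ (a ≡ᵇ d)
sameRel-11 zero    zero    = refl
sameRel-11 zero    (suc d) = refl
sameRel-11 (suc a) zero    = refl
sameRel-11 (suc a) (suc d) = sameRel-11 a d

sameRel-12 : ∀ a d → sameRel (a , 1) (d , 2) ≡ (a <ᵇ d)
sameRel-12 zero    zero    = refl
sameRel-12 zero    (suc d) = refl
sameRel-12 (suc a) zero    = refl
sameRel-12 (suc a) (suc d) = sameRel-12 a d

sameRel-21 : ∀ a d → sameRel (d , 2) (a , 1) ≡ (a <ᵇ d)
sameRel-21 zero    zero    = refl
sameRel-21 zero    (suc d) = refl
sameRel-21 (suc a) zero    = refl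
sameRel-21 (suc a) (suc d) = sameRel-21 a d

sameRel-22 : ∀ d → sameRel (d , 2) (d , 2) ≡ true
sameRel-22 zero    = refl
sameRel-22 (suc d) = sameRel-22 d

≡ᵇ-refl : ∀ a → (a ≡ᵇ a) ≡ true
≡ᵇ-refl zero    = refl
≡ᵇ-refl (suc a) = ≡ᵇ-refl a

allᵇ-run : ∀ (p : A → Bool) i x y → p x ≡ true → p y ≡ true → allᵇ p (replicate i x ++ [ y ]) ≡ true
allᵇ-run p zero    x y px py rewrite py = refl
allᵇ-run p (suc i) x y px py rewrite px = allᵇ-run p i x y px py

zip-run : ∀ i (a d : A) (x y : B) → zip (replicate i a ++ [ d ]) (replicate i x ++ [ y ]) ≡ replicate i (a , x) ++ [ (d , y) ]
zip-run zero    a d x y = refl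
zip-run (suc i) a d x y = cong ((a , x) ∷_) (zip-run i a d x y)

length-run : ∀ i (x y : A) → length (replicate i x ++ [ y ]) ≡ suc i
length-run zero    x y = refl
length-run (suc i) x y = cong suc (length-run i x y)

orderIso-run : ∀ i a d → (a <ᵇ d) ≡ true → orderIso (replicate i a ++ [ d ]) (replicate i 1 ++ [ 2 ]) ≡ true
orderIso-run i a d a<d rewrite length-run i a d | length-run i 1 2 | zip-run i a d 1 2 =
  cong₂ _∧_ (≡ᵇ-refl i)
    (allᵇ-run _ i (a , 1) (d , 2) (row (a , 1) a≈a (trans (sameRel-12 a d) a<d)) (row (d , 2) (trans (sameRel-21 a d) a<d) (sameRel-22 d)))
  where
  a≈a : sameRel (a , 1) (a , 1) ≡ true
  a≈a = trans (sameRel-11 a a) (≡ᵇ-refl a)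
  row : ∀ x → sameRel x (a , 1) ≡ true → sameRel x (d , 2) ≡ true → allᵇ (sameRel x) (replicate i (a , 1) ++ [ (d , 2) ]) ≡ true
  row x = allᵇ-run (sameRel x) i (a , 1) (d , 2)

firstRow : ∀ a i w → length w ≡ suc i → allᵇ (sameRel (a , 1)) (zip w (replicate i 1 ++ [ 2 ])) ≡ runAscent a i w
firstRow a zero    (d ∷ []) _   = trans (∧-identityʳ _) (sameRel-12 a d)
firstRow a (suc i) (d ∷ w)  len = cong₂ _∧_ (sameRel-11 a d) (firstRow a i w (ℕ.suc-injective len))

runAscent⇒run : ∀ a i w → runAscent a i w ≡ true → ∃₂ λ d rest → (a <ᵇ d) ≡ true × w ≡ replicate i a ++ d ∷ rest
runAscent⇒run a zero    (d ∷ w) a<d = d , w , a<d , refl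
runAscent⇒run a (suc i) (d ∷ w) h
  with runAscent⇒run a i w (∧-conicalʳ _ _ h) | ℕ.≡ᵇ⇒≡ a d (Equivalence.from T-≡ (∧-conicalˡ _ _ h))
... | d′ , rest , a<d′ , refl | refl = d′ , rest , a<d′ , refl

runAscent-take : ∀ a i w → runAscent a i (take (suc i) w) ≡ runAscent a i w
runAscent-take a zero    []      = refl
runAscent-take a zero    (d ∷ w) = refl
runAscent-take a (suc i) []      = refl
runAscent-take a (suc i) (d ∷ w) = cong ((a ≡ᵇ d) ∧_) (runAscent-take a i w)

runAscent-short : ∀ a i w → length w ≤ i → runAscent a i w ≡ false
runAscent-short a zero    []      _             = refl
runAscent-short a (suc i) []      _             = refl
runAscent-short a (suc i) (d ∷ w) (s≤s |w|≤i) = trans (cong ((a ≡ᵇ d) ∧_) (runAscent-short a i w |w|≤i)) (∧-zeroʳ _)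

take-run : ∀ i (a d : ℕ) rest → take (suc i) (replicate i a ++ d ∷ rest) ≡ replicate i a ++ [ d ]
take-run zero    a d rest = refl
take-run (suc i) a d rest = cong (a ∷_) (take-run i a d rest)

orderIso-1ʲ2 : ∀ j a σ → orderIso (take (suc (suc j)) (a ∷ σ)) (pattern1s2 (suc (suc j))) ≡ runAscent a j σ
orderIso-1ʲ2 j a σ = ⇔→≡ (mk⇔ isRunAscent isOrderIso)
  where
  isRunAscent : orderIso (a ∷ take (suc j) σ) (pattern1s2 (suc (suc j))) ≡ true → runAscent a j σ ≡ true
  isRunAscent h = begin
    runAscent a j σ                        ≡⟨ runAscent-take a j σ ⟨
    runAscent a j (take (suc j) σ)         ≡⟨ firstRow a j (take (suc j) σ) length-ok ⟨
    allᵇ (sameRel (a , 1)) pairs           ≡⟨ ∧-conicalʳ (sameRel (a , 1) (a , 1)) _ (∧-conicalˡ _ rest allPairs) ⟩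
    true                                   ∎
    where
    open ≡-Reasoning
    pairs : List (ℕ × ℕ)
    pairs = zip (take (suc j) σ) (replicate j 1 ++ [ 2 ])
    rest lengths : Bool
    rest    = allᵇ (λ x → allᵇ (sameRel x) ((a , 1) ∷ pairs)) pairs
    lengths = length (a ∷ take (suc j) σ) ≡ᵇ length (pattern1s2 (suc (suc j)))
    allPairs : allᵇ (λ x → allᵇ (sameRel x) ((a , 1) ∷ pairs)) ((a , 1) ∷ pairs) ≡ true
    allPairs = ∧-conicalʳ lengths _ h
    length-ok : length (take (suc j) σ) ≡ suc j
    length-ok = ℕ.suc-injective (trans (ℕ.≡ᵇ⇒≡ _ _ (Equivalence.from T-≡ (∧-conicalˡ lengths _ h))) (length-run (suc j) 1 2))
  isOrderIso : runAscent a j σ ≡ true → orderIso (a ∷ take (suc j) σ) (pattern1s2 (suc (suc j))) ≡ true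
  isOrderIso h with runAscent⇒run a j σ h
  ... | d , rest , a<d , refl rewrite take-run j a d rest = orderIso-run (suc j) a d a<d

length-filter-applyUpTo : ∀ (p : ℕ → Bool) f r →
  length (filter (λ i → T? (p i)) (applyUpTo f r)) ≡ length (filter (λ i → T? (p (f i))) (upTo r))
length-filter-applyUpTo p f zero    = refl
length-filter-applyUpTo p f (suc r) with p (f 0)
... | true  = cong suc (trans (length-filter-applyUpTo p (f ∘ suc) r) (sym (length-filter-applyUpTo (p ∘ f) suc r)))
... | false = trans (length-filter-applyUpTo p (f ∘ suc) r) (sym (length-filter-applyUpTo (p ∘ f) suc r))

length-filter-upTo-suc : ∀ (p : ℕ → Bool) r → let c = length (filter (λ i → T? (p (suc i))) (upTo r)) in
  length (filter (λ i → T? (p i)) (upTo (suc r))) ≡ (if p 0 then suc c else c)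
length-filter-upTo-suc p r with p 0
... | true  = cong suc (length-filter-applyUpTo p suc r)
... | false = length-filter-applyUpTo p suc r

matchesAt : ℕ → List ℕ → ℕ → Bool
matchesAt j σ i = orderIso (take (suc (suc j)) (drop i σ)) (pattern1s2 (suc (suc j)))

count-matchesAt : ∀ j σ → length (filter (λ i → T? (matchesAt j σ i)) (upTo (suc (length σ) ∸ suc (suc j)))) ≡ occ j σ
count-matchesAt j []      = refl
count-matchesAt j (a ∷ σ) with suc j ≤? length σ
... | yes j<|σ| rewrite ℕ.+-∸-assoc 1 j<|σ| =
  trans (length-filter-upTo-suc (matchesAt j (a ∷ σ)) (length σ ∸ suc j))
        (cong₂ (λ b c → if b then suc c else c) (orderIso-1ʲ2 j a σ) (count-matchesAt j σ))
... | no j≮|σ| with ℕ.≤-pred (ℕ.≰⇒> j≮|σ|)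
... | |σ|≤j rewrite ℕ.m≤n⇒m∸n≡0 |σ|≤j | runAscent-short a j σ |σ|≤j =
  trans (cong (λ r → length (filter (λ i → T? (matchesAt j σ i)) (upTo r))) (sym (ℕ.m≤n⇒m∸n≡0 (ℕ.m≤n⇒m≤1+n |σ|≤j))))
        (count-matchesAt j σ)

length-pattern1s2 : ∀ j → length (pattern1s2 (suc (suc j))) ≡ suc (suc j)
length-pattern1s2 j = length-run (suc j) 1 2

occurrences-1ʲ2 : ∀ j σ → occurrences (pattern1s2 (suc (suc j))) σ ≡ occ j σ
occurrences-1ʲ2 j σ =
  subst (λ L → length (filter (λ i → T? (orderIso (take L (drop i σ)) (pattern1s2 (suc (suc j))))) (upTo (suc (length σ) ∸ L))) ≡ occ j σ)
        (sym (length-pattern1s2 j)) (count-matchesAt j σ)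

-- Words over {0, …, k - 1}

length-filter-≟ : ∀ (f : A → ℕ) m (xs : List A) → Data.Integer.+ length (filter (λ x → f x ≟ m) xs) ≡ ∑ xs (λ x → δ (f x) m)
length-filter-≟ f m []       = sym (∑-[] _)
length-filter-≟ f m (x ∷ xs) rewrite ∑-∷ x xs (λ x → δ (f x) m) with f x ≡ᵇ m
... | true  = cong (_+_ 1ℤ) (length-filter-≟ f m xs)
... | false = trans (length-filter-≟ f m xs) (sym (ℤ.+-identityˡ _))

-- [k]^n with every letter lowered by one, so that the smallest letter is 0.
words₀ : ℕ → ℕ → List (List ℕ)
words₀ k zero    = [] ∷ []
words₀ k (suc n) = concatMap (λ w → map (_∷ w) (upTo k)) (words₀ k n)

∑-words₀-zero : ∀ k (g : List ℕ → ℤ) → ∑ (words₀ k 0) g ≡ g []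
∑-words₀-zero k = ∑-[-] []

∑-words₀-suc : ∀ k n (g : List ℕ → ℤ) → ∑ (words₀ k (suc n)) g ≡ ∑ (words₀ k n) (λ w → ∑ (upTo k) (λ a → g (a ∷ w)))
∑-words₀-suc k n g = trans (∑-concatMap _ (words₀ k n) g) (∑-cong (words₀ k n) (λ w → ∑-map (_∷ w) (upTo k) g))

∑-words : ∀ k n (h : List ℕ → ℤ) → ∑ (words k n) h ≡ ∑ (words₀ k n) (h ∘ map suc)
∑-words k zero    h = trans (∑-[-] [] h) (sym (∑-[-] [] _))
∑-words k (suc n) h = begin
  ∑ (words k (suc n)) h
    ≡⟨ ∑-concatMap _ (words k n) h ⟩
  ∑ (words k n) (λ w → ∑ (map (λ a → a ∷ w) (letters k)) h)
    ≡⟨ ∑-cong (words k n) (λ w → trans (∑-map (λ a → a ∷ w) (letters k) h) (∑-map suc (upTo k) _)) ⟩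
  ∑ (words k n) (λ w → ∑ (upTo k) (λ a → h (suc a ∷ w)))
    ≡⟨ ∑-words k n _ ⟩
  ∑ (words₀ k n) (λ w → ∑ (upTo k) (λ a → h (suc a ∷ map suc w)))
    ≡⟨ ∑-words₀-suc k n (h ∘ map suc) ⟨
  ∑ (words₀ k (suc n)) (h ∘ map suc) ∎
  where open ≡-Reasoning

startsAbove0 emptyOrStarts0 : List ℕ → Bool
startsAbove0 = runAscent 0 0
emptyOrStarts0 σ = not (startsAbove0 σ)

runAscent-shift : ∀ c i w σ → startsAbove0 σ ≡ false → runAscent (suc c) i (map suc w ++ σ) ≡ runAscent c i w
runAscent-shift c zero    []      []          _  = refl
runAscent-shift c zero    []      (zero ∷ σ)  _  = refl
runAscent-shift c (suc i) []      []          _  = refl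
runAscent-shift c (suc i) []      (zero ∷ σ)  _  = refl
runAscent-shift c zero    (d ∷ w) σ           _  = refl
runAscent-shift c (suc i) (d ∷ w) σ           σ₀ = cong ((c ≡ᵇ d) ∧_) (runAscent-shift c i w σ σ₀)

-- No occurrence straddles w and σ, since σ starts with the smallest letter.
occ-++ : ∀ j w σ → startsAbove0 σ ≡ false → occ j (map suc w ++ σ) ≡ occ j w +ℕ occ j σ
occ-++ j []      σ σ₀ = refl
occ-++ j (a ∷ w) σ σ₀ rewrite runAscent-shift a j w σ σ₀ | occ-++ j w σ σ₀ with runAscent a j w
... | true  = refl
... | false = refl

occ-map-suc : ∀ j w → occ j (map suc w) ≡ occ j w
occ-map-suc j w = begin
  occ j (map suc w)          ≡⟨ cong (occ j) (++-identityʳ (map suc w)) ⟨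
  occ j (map suc w ++ [])    ≡⟨ occ-++ j w [] refl ⟩
  occ j w +ℕ 0              ≡⟨ ℕ.+-identityʳ (occ j w) ⟩
  occ j w                    ∎
  where open ≡-Reasoning

δ-occ-++ : ∀ j w σ m → 𝕀 (emptyOrStarts0 σ) * δ (occ j (map suc w ++ σ)) m
                      ≡ ∑ (upTo (suc m)) (λ b → δ (occ j w) b * (𝕀 (emptyOrStarts0 σ) * δ (occ j σ) (m ∸ b)))
δ-occ-++ j w σ m = begin
  q σ * δ (occ j (map suc w ++ σ)) m                                    ≡⟨ occ-++-weighted ⟩
  q σ * δ (occ j w +ℕ occ j σ) m                                        ≡⟨ cong (q σ *_) (δ-+ (occ j w) (occ j σ) m) ⟩
  q σ * ∑ (upTo (suc m)) (λ b → δ (occ j w) b * δ (occ j σ) (m ∸ b))   ≡⟨ *-distribˡ-∑ (q σ) (upTo (suc m)) _ ⟩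
  ∑ (upTo (suc m)) (λ b → q σ * (δ (occ j w) b * δ (occ j σ) (m ∸ b)))
    ≡⟨ ∑-cong (upTo (suc m)) (λ b → *-comm-middle (q σ) (δ (occ j w) b) _) ⟩
  ∑ (upTo (suc m)) (λ b → δ (occ j w) b * (q σ * δ (occ j σ) (m ∸ b))) ∎
  where
  open ≡-Reasoning
  q : List ℕ → ℤ
  q σ = 𝕀 (emptyOrStarts0 σ)
  occ-++-weighted : q σ * δ (occ j (map suc w ++ σ)) m ≡ q σ * δ (occ j w +ℕ occ j σ) m
  occ-++-weighted with startsAbove0 σ in σ₀
  ... | true  = refl
  ... | false = cong (λ o → 1ℤ * δ o m) (occ-++ j w σ σ₀)
  *-comm-middle : ∀ (x y z : ℤ) → x * (y * z) ≡ y * (x * z)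
  *-comm-middle = solve-∀

runAscent-inside-run : ∀ {i j} ρ → i < j → startsAbove0 ρ ≡ true → runAscent 0 j (replicate i 0 ++ ρ) ≡ false
runAscent-inside-run {zero}  {suc j} (suc d ∷ ρ) _         _  = refl
runAscent-inside-run {suc i} {suc j} ρ           (s≤s i<j) ρ₀ = runAscent-inside-run ρ i<j ρ₀

occ-run : ∀ {i j} ρ → i ≤ j → startsAbove0 ρ ≡ true → occ j (replicate i 0 ++ ρ) ≡ occ j ρ
occ-run {zero}  ρ _   _  = refl
occ-run {suc i} ρ i<j ρ₀ rewrite runAscent-inside-run ρ i<j ρ₀ = occ-run ρ (ℕ.<⇒≤ i<j) ρ₀

δ-occ-0∷ : ∀ j ρ m → δ (occ j (0 ∷ ρ)) m ≡ δ (occ j ρ) m + 𝕀 (runAscent 0 j ρ) * (δ (suc (occ j ρ)) m - δ (occ j ρ) m)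
δ-occ-0∷ j ρ m with runAscent 0 j ρ
... | true  = add-difference (δ (occ j ρ) m) (δ (suc (occ j ρ)) m)
  where
  add-difference : ∀ (x y : ℤ) → y ≡ x + 1ℤ * (y - x)
  add-difference = solve-∀
... | false = sym (trans (cong (δ (occ j ρ) m +_) (ℤ.*-zeroˡ (δ (suc (occ j ρ)) m - δ (occ j ρ) m))) (ℤ.+-identityʳ _))

-- Generating functions

-- F₀ j k is F_τ(x, y; k) for τ = 1^{j+1}2, i.e. l = j + 2; F₀ᵖ only counts the words satisfying p.
F₀ : ℕ → ℕ → PS
F₀ j k n m = ∑ (words₀ k n) (λ σ → δ (occ j σ) m)

F₀ᵖ : ℕ → ℕ → (List ℕ → Bool) → PS
F₀ᵖ j k p n m = ∑ (words₀ k n) (λ σ → 𝕀 (p σ) * δ (occ j σ) m)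

F≈F₀ : ∀ j k → F (pattern1s2 (suc (suc j))) k ≈ F₀ j k
F≈F₀ j k = coefficientwise λ n m → begin
  F (pattern1s2 (suc (suc j))) k n m
    ≡⟨ length-filter-≟ _ m (words k n) ⟩
  ∑ (words k n) (λ σ → δ (occurrences (pattern1s2 (suc (suc j))) σ) m)
    ≡⟨ ∑-cong (words k n) (λ σ → cong (λ o → δ o m) (occurrences-1ʲ2 j σ)) ⟩
  ∑ (words k n) (λ σ → δ (occ j σ) m)
    ≡⟨ ∑-words k n _ ⟩
  ∑ (words₀ k n) (λ σ → δ (occ j (map suc σ)) m)
    ≡⟨ ∑-cong (words₀ k n) (λ σ → cong (λ o → δ o m) (occ-map-suc j σ)) ⟩
  F₀ j k n m ∎
  where open ≡-Reasoning

-- The unique factorisation of a word over {0, …, k} before its first letter 0.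
∑-words₀-split : ∀ k n (h : List ℕ → ℤ) →
  ∑ (words₀ (suc k) n) h
  ≡ ∑ (upTo (suc n)) (λ a → ∑ (words₀ k a) (λ w → ∑ (words₀ (suc k) (n ∸ a)) (λ σ → 𝕀 (emptyOrStarts0 σ) * h (map suc w ++ σ))))
∑-words₀-split k zero h = begin
  ∑ (words₀ (suc k) 0) h                                            ≡⟨ ∑-words₀-zero (suc k) h ⟩
  h []                                                              ≡⟨ ℤ.*-identityˡ (h []) ⟨
  1ℤ * h []                                                         ≡⟨ ∑-words₀-zero (suc k) _ ⟨
  ∑ (words₀ (suc k) 0) (λ σ → 𝕀 (emptyOrStarts0 σ) * h σ)           ≡⟨ ∑-words₀-zero k _ ⟨
  ∑ (words₀ k 0) (λ w → ∑ (words₀ (suc k) 0) (λ σ → 𝕀 (emptyOrStarts0 σ) * h (map suc w ++ σ)))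
    ≡⟨ ∑-upTo-1 _ ⟨
  ∑ (upTo 1) (λ a → ∑ (words₀ k a) (λ w → ∑ (words₀ (suc k) (0 ∸ a)) (λ σ → 𝕀 (emptyOrStarts0 σ) * h (map suc w ++ σ)))) ∎
  where open ≡-Reasoning
∑-words₀-split k (suc n) h = begin
  ∑ (words₀ (suc k) (suc n)) h
    ≡⟨ ∑-words₀-suc (suc k) n h ⟩
  ∑ (words₀ (suc k) n) (λ ρ → ∑ (upTo (suc k)) (λ a → h (a ∷ ρ)))
    ≡⟨ ∑-cong (words₀ (suc k) n) (λ ρ → ∑-upTo-suc k _) ⟩
  ∑ (words₀ (suc k) n) (λ ρ → h (0 ∷ ρ) + ∑ (upTo k) (λ a → h (suc a ∷ ρ)))
    ≡⟨ ∑-distrib-+ (words₀ (suc k) n) _ _ ⟩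
  ∑ (words₀ (suc k) n) (λ ρ → h (0 ∷ ρ)) + ∑ (words₀ (suc k) n) (λ ρ → ∑ (upTo k) (λ a → h (suc a ∷ ρ)))
    ≡⟨ cong₂ _+_ (sym splitAt0) (∑-words₀-split k n _) ⟩
  G 0 + ∑ (upTo (suc n)) (λ a → ∑ (words₀ k a) (λ w → ∑ (words₀ (suc k) (n ∸ a)) (λ σ →
          q σ * ∑ (upTo k) (λ b → h (suc b ∷ map suc w ++ σ)))))
    ≡⟨ cong (G 0 +_) (∑-cong (upTo (suc n)) splitAfter0) ⟩
  G 0 + ∑ (upTo (suc n)) (G ∘ suc)
    ≡⟨ ∑-upTo-suc (suc n) G ⟨
  ∑ (upTo (suc (suc n))) G ∎
  where
  open ≡-Reasoning
  q : List ℕ → ℤ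
  q σ = 𝕀 (emptyOrStarts0 σ)
  G : ℕ → ℤ
  G a = ∑ (words₀ k a) (λ w → ∑ (words₀ (suc k) (suc n ∸ a)) (λ σ → q σ * h (map suc w ++ σ)))
  splitAt0 : G 0 ≡ ∑ (words₀ (suc k) n) (λ ρ → h (0 ∷ ρ))
  splitAt0 = begin
    G 0                                                               ≡⟨ ∑-words₀-zero k _ ⟩
    ∑ (words₀ (suc k) (suc n)) (λ σ → q σ * h σ)                      ≡⟨ ∑-words₀-suc (suc k) n _ ⟩
    ∑ (words₀ (suc k) n) (λ ρ → ∑ (upTo (suc k)) (λ a → q (a ∷ ρ) * h (a ∷ ρ)))
      ≡⟨ ∑-cong (words₀ (suc k) n) (λ ρ → trans (∑-upTo-head k (λ a → ℤ.*-zeroˡ (h (suc a ∷ ρ)))) (ℤ.*-identityˡ (h (0 ∷ ρ)))) ⟩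
    ∑ (words₀ (suc k) n) (λ ρ → h (0 ∷ ρ))                            ∎
  splitAfter0 : ∀ a → ∑ (words₀ k a) (λ w → ∑ (words₀ (suc k) (n ∸ a)) (λ σ → q σ * ∑ (upTo k) (λ b → h (suc b ∷ map suc w ++ σ))))
                      ≡ G (suc a)
  splitAfter0 a = begin
    ∑ (words₀ k a) (λ w → ∑ (words₀ (suc k) (n ∸ a)) (λ σ → q σ * ∑ (upTo k) (λ b → h (suc b ∷ map suc w ++ σ))))
      ≡⟨ ∑-cong (words₀ k a) (λ w → ∑-cong (words₀ (suc k) (n ∸ a)) (λ σ → *-distribˡ-∑ (q σ) (upTo k) _)) ⟩
    ∑ (words₀ k a) (λ w → ∑ (words₀ (suc k) (n ∸ a)) (λ σ → ∑ (upTo k) (λ b → q σ * h (suc b ∷ map suc w ++ σ))))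
      ≡⟨ ∑-cong (words₀ k a) (λ w → ∑-comm (words₀ (suc k) (n ∸ a)) (upTo k) _) ⟩
    ∑ (words₀ k a) (λ w → ∑ (upTo k) (λ b → ∑ (words₀ (suc k) (n ∸ a)) (λ σ → q σ * h (map suc (b ∷ w) ++ σ))))
      ≡⟨ ∑-words₀-suc k a _ ⟨
    G (suc a) ∎

F₀-suc : ∀ j k → F₀ j (suc k) ≈ F₀ j k ⊛ F₀ᵖ j (suc k) emptyOrStarts0
F₀-suc j k = coefficientwise λ n m → begin
  F₀ j (suc k) n m
    ≡⟨ ∑-words₀-split k n _ ⟩
  ∑ (upTo (suc n)) (λ a → ∑ (words₀ k a) (λ w → ∑ (words₀ (suc k) (n ∸ a)) (λ σ → q σ * δ (occ j (map suc w ++ σ)) m)))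
    ≡⟨ ∑-cong (upTo (suc n)) (factor n m) ⟩
  ∑ (upTo (suc n)) (λ a → ∑ (upTo (suc m)) (λ b → F₀ j k a b * Q (n ∸ a) (m ∸ b)))
    ≡⟨ ⊛-coefficient (F₀ j k) Q n m ⟨
  (F₀ j k ⊛ Q) n m ∎
  where
  open ≡-Reasoning
  q : List ℕ → ℤ
  q σ = 𝕀 (emptyOrStarts0 σ)
  Q : PS
  Q = F₀ᵖ j (suc k) emptyOrStarts0
  factor : ∀ n m a → ∑ (words₀ k a) (λ w → ∑ (words₀ (suc k) (n ∸ a)) (λ σ → q σ * δ (occ j (map suc w ++ σ)) m))
                     ≡ ∑ (upTo (suc m)) (λ b → F₀ j k a b * Q (n ∸ a) (m ∸ b))
  factor n m a = begin
    ∑ (words₀ k a) (λ w → ∑ (words₀ (suc k) (n ∸ a)) (λ σ → q σ * δ (occ j (map suc w ++ σ)) m))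
      ≡⟨ ∑-cong (words₀ k a) (λ w → trans (∑-cong (words₀ (suc k) (n ∸ a)) (λ σ → δ-occ-++ j w σ m))
                                          (∑-comm (words₀ (suc k) (n ∸ a)) (upTo (suc m)) _)) ⟩
    ∑ (words₀ k a) (λ w → ∑ (upTo (suc m)) (λ b → ∑ (words₀ (suc k) (n ∸ a)) (λ σ → δ (occ j w) b * (q σ * δ (occ j σ) (m ∸ b)))))
      ≡⟨ ∑-cong (words₀ k a) (λ w → ∑-cong (upTo (suc m)) (λ b → *-distribˡ-∑ (δ (occ j w) b) (words₀ (suc k) (n ∸ a)) _)) ⟨
    ∑ (words₀ k a) (λ w → ∑ (upTo (suc m)) (λ b → δ (occ j w) b * Q (n ∸ a) (m ∸ b)))
      ≡⟨ ∑-comm (words₀ k a) (upTo (suc m)) _ ⟩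
    ∑ (upTo (suc m)) (λ b → ∑ (words₀ k a) (λ w → δ (occ j w) b * Q (n ∸ a) (m ∸ b)))
      ≡⟨ ∑-cong (upTo (suc m)) (λ b → *-distribʳ-∑ (Q (n ∸ a) (m ∸ b)) (words₀ k a) _) ⟨
    ∑ (upTo (suc m)) (λ b → F₀ j k a b * Q (n ∸ a) (m ∸ b)) ∎

F₀-split : ∀ j k (p : List ℕ → Bool) → F₀ j k ≈ F₀ᵖ j k (not ∘ p) ⊕ F₀ᵖ j k p
F₀-split j k p = coefficientwise λ n m →
  trans (∑-cong (words₀ k n) (λ σ → split (p σ) (δ (occ j σ) m))) (∑-distrib-+ (words₀ k n) _ _)
  where
  split : ∀ b (x : ℤ) → x ≡ 𝕀 (not b) * x + 𝕀 b * x
  split true  x = sym (trans (ℤ.+-identityˡ _) (ℤ.*-identityˡ x))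
  split false x = sym (trans (ℤ.+-identityʳ _) (ℤ.*-identityˡ x))

-- The words ρ with runAscent 0 i ρ are 0^i ρ′ with ρ′ starting above 0.
∑-runAscent : ∀ k i n (g : List ℕ → ℤ) →
  ∑ (words₀ (suc k) n) (λ ρ → 𝕀 (runAscent 0 i ρ) * g ρ)
  ≡ shift i (λ n′ → ∑ (words₀ (suc k) n′) (λ ρ → 𝕀 (startsAbove0 ρ) * g (replicate i 0 ++ ρ))) n
∑-runAscent k zero    n       g = refl
∑-runAscent k (suc i) zero    g = trans (∑-words₀-zero (suc k) _) (ℤ.*-zeroˡ (g []))
∑-runAscent k (suc i) (suc n) g = begin
  ∑ (words₀ (suc k) (suc n)) (λ ρ → 𝕀 (runAscent 0 (suc i) ρ) * g ρ)
    ≡⟨ ∑-words₀-suc (suc k) n _ ⟩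
  ∑ (words₀ (suc k) n) (λ ρ → ∑ (upTo (suc k)) (λ a → 𝕀 (runAscent 0 (suc i) (a ∷ ρ)) * g (a ∷ ρ)))
    ≡⟨ ∑-cong (words₀ (suc k) n) (λ ρ → ∑-upTo-head k (λ a → ℤ.*-zeroˡ (g (suc a ∷ ρ)))) ⟩
  ∑ (words₀ (suc k) n) (λ ρ → 𝕀 (runAscent 0 i ρ) * g (0 ∷ ρ))
    ≡⟨ ∑-runAscent k i n (g ∘ (0 ∷_)) ⟩
  shift (suc i) (λ n′ → ∑ (words₀ (suc k) n′) (λ ρ → 𝕀 (startsAbove0 ρ) * g (replicate (suc i) 0 ++ ρ))) (suc n) ∎
  where open ≡-Reasoning

F₀-zero : ∀ j → F₀ j 0 ≈ 𝟙
F₀-zero j = coefficientwise λ where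
  zero    m → trans (∑-words₀-zero 0 _) (δ₀≡𝟙₀ m)
  (suc n) m → trans (∑-words₀-suc 0 n _) (∑-zero (words₀ 0 n) (λ w → ∑-[] _))

module _ (j k : ℕ) where

  private
    W : ℕ → List (List ℕ)
    W = words₀ (suc k)
    Z Q N : PS
    Z = F₀ᵖ j (suc k) startsAbove0
    Q = F₀ᵖ j (suc k) emptyOrStarts0
    N = X ^ˢ j ⊛ (𝟙 ⊝ Y)

  ∑-startsAbove0-δ-suc : ∀ n m → ∑ (W n) (λ ρ → 𝕀 (startsAbove0 ρ) * δ (suc (occ j ρ)) m) ≡ (Y ⊛ Z) n m
  ∑-startsAbove0-δ-suc n zero    = trans (∑-zero (W n) (λ ρ → ℤ.*-zeroʳ (𝕀 (startsAbove0 ρ)))) (sym (Y-⊛ Z n 0))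
  ∑-startsAbove0-δ-suc n (suc m) = sym (Y-⊛ Z n (suc m))

  ∑-startsAbove0-Δ : ∀ n m → ∑ (W n) (λ ρ → 𝕀 (startsAbove0 ρ) * (δ (suc (occ j ρ)) m - δ (occ j ρ) m)) ≡ - ((𝟙 ⊝ Y) ⊛ Z) n m
  ∑-startsAbove0-Δ n m = begin
    ∑ (W n) (λ ρ → 𝕀 (startsAbove0 ρ) * (δ (suc (occ j ρ)) m - δ (occ j ρ) m))
      ≡⟨ ∑-cong (W n) (λ ρ → ℤ.*-distribˡ-+ (𝕀 (startsAbove0 ρ)) _ _) ⟩
    ∑ (W n) (λ ρ → 𝕀 (startsAbove0 ρ) * δ (suc (occ j ρ)) m + 𝕀 (startsAbove0 ρ) * - δ (occ j ρ) m)
      ≡⟨ ∑-distrib-+ (W n) _ _ ⟩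
    ∑ (W n) (λ ρ → 𝕀 (startsAbove0 ρ) * δ (suc (occ j ρ)) m) + ∑ (W n) (λ ρ → 𝕀 (startsAbove0 ρ) * - δ (occ j ρ) m)
      ≡⟨ cong₂ _+_ (∑-startsAbove0-δ-suc n m) (∑-cong (W n) (λ ρ → sym (ℤ.neg-distribʳ-* (𝕀 (startsAbove0 ρ)) _))) ⟩
    (Y ⊛ Z) n m + ∑ (W n) (λ ρ → - (𝕀 (startsAbove0 ρ) * δ (occ j ρ) m))
      ≡⟨ cong ((Y ⊛ Z) n m +_) (-‿distrib-∑ (W n) _) ⟨
    (Y ⊛ Z) n m - Z n m
      ≡⟨ coeff (solve 2 (λ y z → :- ((con 1ℤ :- y) :* z) := y :* z :- z) ≈-refl Y Z) n m ⟨
    - ((𝟙 ⊝ Y) ⊛ Z) n m ∎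
    where open ≡-Reasoning

  Q-coefficient-zero : ∀ m → Q 0 m ≡ 𝟙 0 m
  Q-coefficient-zero m = trans (∑-words₀-zero (suc k) _) (trans (ℤ.*-identityˡ (δ 0 m)) (δ₀≡𝟙₀ m))

  Q-coefficient-suc : ∀ n m → Q (suc n) m ≡ F₀ j (suc k) n m - (N ⊛ Z) n m
  Q-coefficient-suc n m = begin
    Q (suc n) m
      ≡⟨ ∑-words₀-suc (suc k) n _ ⟩
    ∑ (W n) (λ ρ → ∑ (upTo (suc k)) (λ a → 𝕀 (emptyOrStarts0 (a ∷ ρ)) * δ (occ j (a ∷ ρ)) m))
      ≡⟨ ∑-cong (W n) (λ ρ → trans (∑-upTo-head k (λ a → ℤ.*-zeroˡ (δ (occ j (suc a ∷ ρ)) m))) (ℤ.*-identityˡ _)) ⟩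
    ∑ (W n) (λ ρ → δ (occ j (0 ∷ ρ)) m)
      ≡⟨ ∑-cong (W n) (λ ρ → δ-occ-0∷ j ρ m) ⟩
    ∑ (W n) (λ ρ → δ (occ j ρ) m + 𝕀 (runAscent 0 j ρ) * Δ ρ)
      ≡⟨ ∑-distrib-+ (W n) _ _ ⟩
    F₀ j (suc k) n m + ∑ (W n) (λ ρ → 𝕀 (runAscent 0 j ρ) * Δ ρ)
      ≡⟨ cong (F₀ j (suc k) n m +_) (∑-runAscent k j n Δ) ⟩
    F₀ j (suc k) n m + shift j (λ n′ → ∑ (W n′) (λ ρ → 𝕀 (startsAbove0 ρ) * Δ (replicate j 0 ++ ρ))) n
      ≡⟨ cong (F₀ j (suc k) n m +_) (shift-cong j (λ n′ → ∑-cong (W n′) Δ-run) n) ⟩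
    F₀ j (suc k) n m + shift j (λ n′ → ∑ (W n′) (λ ρ → 𝕀 (startsAbove0 ρ) * Δ ρ)) n
      ≡⟨ cong (F₀ j (suc k) n m +_) (trans (shift-cong j (λ n′ → ∑-startsAbove0-Δ n′ m) n) (shift-neg j _ n)) ⟩
    F₀ j (suc k) n m - shift j (λ n′ → ((𝟙 ⊝ Y) ⊛ Z) n′ m) n
      ≡⟨ cong (_-_ (F₀ j (suc k) n m)) (X^-⊛ j ((𝟙 ⊝ Y) ⊛ Z) n m) ⟨
    F₀ j (suc k) n m - (X ^ˢ j ⊛ ((𝟙 ⊝ Y) ⊛ Z)) n m
      ≡⟨ cong (_-_ (F₀ j (suc k) n m)) (coeff (⊛-assoc (X ^ˢ j) (𝟙 ⊝ Y) Z) n m) ⟨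
    F₀ j (suc k) n m - (N ⊛ Z) n m ∎
    where
    open ≡-Reasoning
    Δ : List ℕ → ℤ
    Δ ρ = δ (suc (occ j ρ)) m - δ (occ j ρ) m
    Δ-run : ∀ ρ → 𝕀 (startsAbove0 ρ) * Δ (replicate j 0 ++ ρ) ≡ 𝕀 (startsAbove0 ρ) * Δ ρ
    Δ-run ρ with startsAbove0 ρ in ρ₀
    ... | true  = cong (λ o → 1ℤ * (δ (suc o) m - δ o m)) (occ-run ρ ℕ.≤-refl ρ₀)
    ... | false = refl

  Q-recurrence : Q ≈ 𝟙 ⊕ X ⊛ (F₀ j (suc k) ⊝ N ⊛ Z)
  Q-recurrence = coefficientwise λ where
      zero    m → trans (Q-coefficient-zero m) (sym (trans (cong (𝟙 0 m +_) (X-⊛ G 0 m)) (ℤ.+-identityʳ _)))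
      (suc n) m → trans (Q-coefficient-suc n m) (sym (trans (cong (𝟙 (suc n) m +_) (X-⊛ G (suc n) m)) (ℤ.+-identityˡ _)))
    where
    G : PS
    G = F₀ j (suc k) ⊝ N ⊛ Z

-- Eliminating Z and A from the hypotheses leaves Q ⊛ W ≈ 𝟙 with W = 𝟙 - x N - x F + x N F.
-- N is split as M ⊛ D so that 𝟙 ⊝ (x ⊛ M) ⊛ D is literally 𝟙 ⊝ X ^ˢ suc j ⊛ (𝟙 ⊝ Y).
recurrence-step : ∀ x M D {A F Q Z P} → let N = M ⊛ D in
  A ≈ Q ⊕ Z → A ≈ F ⊛ Q → Q ≈ 𝟙 ⊕ x ⊛ (A ⊝ N ⊛ Z) → F ⊛ (N ⊝ 𝟙 ⊕ P) ≈ N →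
  A ⊛ (N ⊝ 𝟙 ⊕ (𝟙 ⊝ (x ⊛ M) ⊛ D) ⊛ P) ≈ N
recurrence-step x M D {A} {F} {Q} {Z} {P} A≈Q+Z A≈FQ Q≈𝟙+x[A-NZ] F[N-1+P]≈N = begin
  A ⊛ (N ⊝ 𝟙 ⊕ U ⊛ P)
    ≈⟨ ⊛-cong A≈FQ (≈-refl {N ⊝ 𝟙 ⊕ U ⊛ P}) ⟩
  (F ⊛ Q) ⊛ (N ⊝ 𝟙 ⊕ U ⊛ P)
    ≈⟨ solve 6 (λ f q x m d p → (f :* q) :* (m :* d :- con 1ℤ :+ (con 1ℤ :- (x :* m) :* d) :* p)
                                := q :* (f :* (m :* d :- con 1ℤ) :+ (con 1ℤ :- x :* (m :* d)) :* (f :* p))) ≈-refl F Q x M D P ⟩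
  Q ⊛ (F ⊛ (N ⊝ 𝟙) ⊕ (𝟙 ⊝ x ⊛ N) ⊛ (F ⊛ P))
    ≈⟨ ⊛-cong (≈-refl {Q}) (⊕-cong (≈-refl {F ⊛ (N ⊝ 𝟙)}) (⊛-cong (≈-refl {𝟙 ⊝ x ⊛ N}) FP≈N-F[N-1])) ⟩
  Q ⊛ (F ⊛ (N ⊝ 𝟙) ⊕ (𝟙 ⊝ x ⊛ N) ⊛ (N ⊝ F ⊛ (N ⊝ 𝟙)))
    ≈⟨ solve 4 (λ f q n x → q :* (f :* (n :- con 1ℤ) :+ (con 1ℤ :- x :* n) :* (n :- f :* (n :- con 1ℤ)))
                            := (q :* (con 1ℤ :- x :* n :- x :* f :+ x :* n :* f)) :* n) ≈-refl F Q N x ⟩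
  (Q ⊛ W) ⊛ N
    ≈⟨ ⊛-cong QW≈𝟙 (≈-refl {N}) ⟩
  𝟙 ⊛ N
    ≈⟨ ⊛-identityˡ N ⟩
  N ∎
  where
  open ≈-Reasoning
  N U W : PS
  N = M ⊛ D
  U = 𝟙 ⊝ (x ⊛ M) ⊛ D
  W = 𝟙 ⊝ x ⊛ N ⊝ x ⊛ F ⊕ x ⊛ N ⊛ F
  FP≈N-F[N-1] : F ⊛ P ≈ N ⊝ F ⊛ (N ⊝ 𝟙)
  FP≈N-F[N-1] = begin
    F ⊛ P                            ≈⟨ solve 3 (λ f n p → f :* p := f :* (n :- con 1ℤ :+ p) :- f :* (n :- con 1ℤ)) ≈-refl F N P ⟩
    F ⊛ (N ⊝ 𝟙 ⊕ P) ⊝ F ⊛ (N ⊝ 𝟙)    ≈⟨ ⊕-cong F[N-1+P]≈N (≈-refl {⊖ (F ⊛ (N ⊝ 𝟙))}) ⟩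
    N ⊝ F ⊛ (N ⊝ 𝟙)                  ∎
  Z≈FQ-Q : Z ≈ F ⊛ Q ⊝ Q
  Z≈FQ-Q = begin
    Z              ≈⟨ solve 2 (λ q z → z := (q :+ z) :- q) ≈-refl Q Z ⟩
    Q ⊕ Z ⊝ Q      ≈⟨ ⊕-cong (≈-trans (≈-sym A≈Q+Z) A≈FQ) (≈-refl {⊖ Q}) ⟩
    F ⊛ Q ⊝ Q      ∎
  Q≈𝟙+x[FQ-N[FQ-Q]] : Q ≈ 𝟙 ⊕ x ⊛ (F ⊛ Q ⊝ N ⊛ (F ⊛ Q ⊝ Q))
  Q≈𝟙+x[FQ-N[FQ-Q]] = ≈-trans Q≈𝟙+x[A-NZ]
    (⊕-cong (≈-refl {𝟙}) (⊛-cong (≈-refl {x}) (⊕-cong A≈FQ (⊖-cong (⊛-cong (≈-refl {N}) Z≈FQ-Q)))))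
  QW≈𝟙 : Q ⊛ W ≈ 𝟙
  QW≈𝟙 = begin
    Q ⊛ W
      ≈⟨ solve 4 (λ f q n x → q :* (con 1ℤ :- x :* n :- x :* f :+ x :* n :* f)
                              := con 1ℤ :+ q :- (con 1ℤ :+ x :* (f :* q :- n :* (f :* q :- q)))) ≈-refl F Q N x ⟩
    𝟙 ⊕ Q ⊝ (𝟙 ⊕ x ⊛ (F ⊛ Q ⊝ N ⊛ (F ⊛ Q ⊝ Q)))
      ≈⟨ ⊕-cong (≈-refl {𝟙 ⊕ Q}) (⊖-cong (≈-sym Q≈𝟙+x[FQ-N[FQ-Q]])) ⟩
    𝟙 ⊕ Q ⊝ Q
      ≈⟨ solve 1 (λ q → con 1ℤ :+ q :- q := con 1ℤ) ≈-refl Q ⟩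
    𝟙 ∎

F₀-formula : ∀ j k → F₀ j k ⊛ (X ^ˢ j ⊛ (𝟙 ⊝ Y) ⊝ 𝟙 ⊕ (𝟙 ⊝ X ^ˢ suc j ⊛ (𝟙 ⊝ Y)) ^ˢ k) ≈ X ^ˢ j ⊛ (𝟙 ⊝ Y)
F₀-formula j zero = begin
  F₀ j 0 ⊛ (N ⊝ 𝟙 ⊕ 𝟙)  ≈⟨ ⊛-cong (F₀-zero j) (≈-refl {N ⊝ 𝟙 ⊕ 𝟙}) ⟩
  𝟙 ⊛ (N ⊝ 𝟙 ⊕ 𝟙)       ≈⟨ solve 1 (λ n → con 1ℤ :* (n :- con 1ℤ :+ con 1ℤ) := n) ≈-refl N ⟩
  N                     ∎
  where
  open ≈-Reasoning
  N : PS
  N = X ^ˢ j ⊛ (𝟙 ⊝ Y)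
F₀-formula j (suc k) =
  recurrence-step X (X ^ˢ j) (𝟙 ⊝ Y) {F = F₀ j k} {P = (𝟙 ⊝ X ^ˢ suc j ⊛ (𝟙 ⊝ Y)) ^ˢ k}
    (F₀-split j (suc k) startsAbove0) (F₀-suc j k) (Q-recurrence j k) (F₀-formula j k)

theorem2p2 : (l : ℕ) → 2 ≤ l → (k : ℕ) → (n m : ℕ) →
    (F (pattern1s2 l) k ⊛ (X ^ˢ (l ∸ 2) ⊛ (𝟙 ⊝ Y) ⊝ 𝟙 ⊕ (𝟙 ⊝ X ^ˢ (l ∸ 1) ⊛ (𝟙 ⊝ Y)) ^ˢ k)) n m
      ≡ (X ^ˢ (l ∸ 2) ⊛ (𝟙 ⊝ Y)) n m
theorem2p2 (suc (suc j)) (s≤s (s≤s z≤n)) k = coeff (≈-trans (⊛-cong (F≈F₀ j k) ≈-refl) (F₀-formula j k))
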